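{- For any asynchronous collective tree exploration algorithm $\mathcal{B}$ (for $k$ robots), there is a collective tree exploration algorithm $\mathcal{A}$ (for $k$ robots) such that for every tree $T$ of depth $D$, $$\texttt{Runtime}(\mathcal{A},k,T)\leq \left\lceil\frac{1}{k}\texttt{Moves}(\mathcal{B},k,T)\right\rceil+D.$$
   Context: Collective tree exploration (CTE): $k$ robots start at the root of an unknown rooted tree $T$; in synchronous rounds every robot stays or moves along an adjacent edge; when a robot reaches a node its adjacent edges are revealed; robots are centrally controlled by one algorithm using only revealed information. $\texttt{Runtime}(\mathcal{A},k,T)$ is the number of rounds until all edges are traversed and all robots are back at the root. Asynchronous collective tree exploration (ACTE): $k$ robots start at the root of an unknown tree $T$. At each step $t$ an arbitrary (adversarially chosen) robot $r_t\in\{1,\dots,k\}$ is the only one allowed to move, and it moves along one adjacent edge. At the beginning of move $t$, the centrally controlled team is only additionally told whether $r_t$ is adjacent to an unexplored edge, and if so is given the ability to move along it. A node is mined once all its adjacent edges are explored and the team has learned that it has no further unexplored adjacent edge. Exploration ends when all nodes have been discovered and mined (robots need not return to the root). $\texttt{Moves}(\mathcal{B},k,T)$ is the maximum, over all sequences $r_0,r_1,\dots$, of the number of moves needed by algorithm $\mathcal{B}$ to traverse all edges of $T$. -}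

module Defs where

open import Data.Nat using (ℕ; zero; suc; _+_; _∸_; _≤_; _<?_; _⊔_; NonZero)
open import Data.Nat.DivMod using (_/_)
import Data.Nat.Properties as ℕP
open import Data.Bool using (Bool; true; false; if_then_else_)
open import Data.Fin using (Fin)
open import Data.List using (List; []; _∷_; length; _++_; concat)
import Data.List.Properties as LP
open import Data.List.Membership.Propositional using (_∈_)
open import Data.Maybe using (Maybe; just; nothing; maybe; is-just; Is-just; _>>=_)
open import Data.Vec using (Vec; lookup; replicate; _[_]≔_; toList; map; zipWith)
open import Data.Product using (_×_; _,_; ∃; proj₁; proj₂)
open import Relation.Nullary using (yes; no)
open import Relation.Nullary.Decidable using (⌊_⌋)
open import Relation.Binary.PropositionalEquality using (_≡_)

data Tree : Set where
  node : List Tree → Tree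

-- A node is addressed by a path from the root, stored REVERSED:
-- (i ∷ p) is the i-th child of the node addressed by p; [] is the root.
-- The edge between (i ∷ p) and its parent p is identified with (i ∷ p).
Path : Set
Path = List ℕ

childAt : ℕ → List Tree → Maybe Tree
childAt _       []       = nothing
childAt zero    (t ∷ _)  = just t
childAt (suc i) (_ ∷ ts) = childAt i ts

at : Tree → Path → Maybe Tree
at T []      = just T
at T (i ∷ p) = at T p >>= λ { (node ts) → childAt i ts }

deg : Tree → Path → ℕ
deg T p = maybe (λ { (node ts) → length ts }) 0 (at T p)

mutual
  depth : Tree → ℕ
  depth (node ts) = depthL ts

  depthL : List Tree → ℕ
  depthL []       = 0
  depthL (t ∷ ts) = suc (depth t) ⊔ depthL ts

AllTraversed : Tree → List Path → Set
AllTraversed T trav = ∀ i p → Is-just (at T (i ∷ p)) → (i ∷ p) ∈ trav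

_∈?_ : (x : Path) (xs : List Path) → Bool
x ∈? xs = ⌊ Data.List.Membership.DecPropositional._∈?_ (LP.≡-dec ℕP._≟_) x xs ⌋
  where import Data.List.Membership.DecPropositional

⌈_/_⌉ : ℕ → (k : ℕ) → .{{NonZero k}} → ℕ
⌈ m / k ⌉ = (m + (k ∸ 1)) / k

data Move : Set where
  stay : Move
  up   : Move
  down : ℕ → Move

-- What the team sees in a round: for each robot, the number of children
-- (i.e. the revealed adjacent edges) of the node it currently occupies.
Obs : ℕ → Set
Obs k = Vec ℕ k

-- A CTE algorithm: given the full history of observations (most recent
-- first), choose a move for each robot.  Being a function of the
-- observation history only, it uses only revealed information.
CTEAlg : ℕ → Set
CTEAlg k = List (Obs k) → Vec Move k

-- effect of one robot's move: new position and traversed edges.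
-- Impossible moves (up at root, down along a non-existent port) = stay.
moveC : Tree → Path → Move → Path × List Path
moveC T p stay     = p , []
moveC T [] up      = [] , []
moveC T (i ∷ p) up = p , (i ∷ p) ∷ []
moveC T p (down i) = if ⌊ i <? deg T p ⌋ then (i ∷ p , (i ∷ p) ∷ []) else (p , [])

record CState (k : ℕ) : Set where
  constructor cstate
  field
    cpos  : Vec Path k
    ctrav : List Path
    chist : List (Obs k)
open CState public

observe : ∀ {k} → Tree → Vec Path k → Obs k
observe T ps = map (deg T) ps

cInit : ∀ k → Tree → CState k
cInit k T = cstate (replicate k []) [] (observe T (replicate k []) ∷ [])

cStep : ∀ {k} → Tree → CTEAlg k → CState k → CState k
cStep T A (cstate ps tr h) =
  let res = zipWith (moveC T) ps (A h)
      ps' = map proj₁ res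
  in cstate ps' (tr ++ concat (toList (map proj₂ res))) (observe T ps' ∷ h)

cRun : ∀ {k} → Tree → CTEAlg k → ℕ → CState k
cRun {k} T A zero    = cInit k T
cRun     T A (suc t) = cStep T A (cRun T A t)

RuntimeAtMost : ∀ {k} → CTEAlg k → Tree → ℕ → Set
RuntimeAtMost {k} A T n =
  ∃ λ t → t ≤ n × AllTraversed T (ctrav (cRun T A t))
                × cpos (cRun T A t) ≡ replicate k []

data AMove : Set where
  aUp      : AMove
  aDown    : ℕ → AMove      -- move to child with port i along an EXPLORED edge
  aExplore : AMove          -- move along the offered unexplored edge

-- A ACTE algorithm: given the history of (selected robot, whether it is
-- adjacent to an unexplored edge), most recent (current step) first,
-- choose the move of the selected robot.
ACTEAlg : ℕ → Set
ACTEAlg k = List (Fin k × Bool) → AMove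

firstUnexpl : ℕ → ℕ → Path → List Path → Maybe ℕ
firstUnexpl zero    i p tr = nothing
firstUnexpl (suc n) i p tr =
  if (i ∷ p) ∈? tr then firstUnexpl n (suc i) p tr else just i

record AState (k : ℕ) : Set where
  constructor astate
  field
    apos  : Vec Path k
    atrav : List Path
    ahist : List (Fin k × Bool)
open AState public

aInit : ∀ k → AState k
aInit k = astate (replicate k []) [] []

moveA : Tree → Path → List Path → Maybe ℕ → AMove → Path × List Path
moveA T []      tr u aUp       = [] , []
moveA T (i ∷ p) tr u aUp       = p , (i ∷ p) ∷ []
moveA T p       tr u (aDown i) = if (i ∷ p) ∈? tr then (i ∷ p , []) else (p , [])
moveA T p       tr nothing  aExplore = p , []
moveA T p       tr (just i) aExplore = i ∷ p , (i ∷ p) ∷ []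

aStep : ∀ {k} → Tree → ACTEAlg k → AState k → Fin k → AState k
aStep T B (astate ps tr h) r =
  let p   = lookup ps r
      u   = firstUnexpl (deg T p) 0 p tr
      h'  = (r , is-just u) ∷ h
      res = moveA T p tr u (B h')
  in astate (ps [ r ]≔ proj₁ res) (tr ++ proj₂ res) h'

aRun : ∀ {k} → Tree → ACTEAlg k → (ℕ → Fin k) → ℕ → AState k
aRun {k} T B r zero    = aInit k
aRun     T B r (suc t) = aStep T B (aRun T B r t) (r t)

MovesAtMost : ∀ {k} → ACTEAlg k → Tree → ℕ → Set
MovesAtMost {k} B T m =
  ∀ (r : ℕ → Fin k) → ∃ λ t → t ≤ m × AllTraversed T (atrav (aRun T B r t))

-- The team simulates B against the round-robin adversary r t = t mod k: in round s, robot l performs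
-- step s k + l of B. Robot l moves only at its own step, so it is still at the node where the round
-- began, whose degree (all that B is told) the team has just observed; each asynchronous move is
-- replayed as one synchronous move, so every edge traversed by B is traversed by the team. The team
-- records the degrees it observes and, in the first round in which every node it has reached is
-- mined (its degree is recorded and all edges below it are traversed), it knows that the whole tree
-- is explored and walks every robot up to the root in depth T rounds. If B explores T within t ≤ m
-- moves, this happens by round ⌈ t / k ⌉, so the runtime is at most ⌈ m / k ⌉ + depth T.

module Submission where

open import Defs
open import Data.Nat using (ℕ; _+_; NonZero)
open import Data.Product using (Σ)

open import Data.Nat using (zero; suc; pred; _*_; _∸_; _≤_; _<_; z≤n; s≤s; s≤s⁻¹; _<?_)
open import Data.Nat.Properties
open import Data.Nat.DivMod
  using (_mod_; _%_; m%n<n; m<n⇒m%n≡m; [m+kn]%n≡m%n; m≡m%n+[m/n]*n; /-monoˡ-≤)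
open import Data.Fin using (Fin; toℕ; fromℕ<)
import Data.Fin.Properties as Fin
open import Data.List using (List; []; _∷_; length; _++_; concat)
import Data.List.Properties as List
open import Data.List.Membership.Propositional using (_∈_)
import Data.List.Membership.DecPropositional as DecMembership
open import Data.List.Membership.Propositional.Properties using (∈-++⁺ˡ; ∈-++⁺ʳ; ∈-++⁻; ∈-concat⁺′)
open import Data.List.Relation.Binary.Subset.Propositional using (_⊆_)
open import Data.List.Relation.Unary.Any using (here; there)
open import Data.List.Relation.Unary.All as All using (All)
open import Data.Maybe using (Maybe; just; nothing; Is-just; is-just)
import Data.Maybe.Relation.Unary.Any as Maybe
open import Data.Vec as Vec using (Vec; lookup; _∷_; []; _[_]≔_; replicate; tabulate; zipWith; toList)
import Data.Vec.Properties as Vec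
open import Data.Vec.Membership.Propositional.Properties using (∈-lookup; ∈-toList⁺)
open import Data.Vec.Relation.Binary.Pointwise.Extensional using (ext; extensional⇒inductive)
open import Data.Vec.Relation.Binary.Pointwise.Inductive using (Pointwise-≡⇒≡)
open import Data.Bool using (Bool; true; false; if_then_else_) renaming (T to True)
open import Data.Unit using (tt)
open import Data.Product using (_×_; _,_; proj₁; proj₂; ∃)
open import Data.Sum using (_⊎_; inj₁; inj₂)
open import Function using (_∘_)
open import Relation.Nullary using (Dec; yes; no; ¬_; contradiction)
open import Relation.Nullary.Decidable using (toWitness)
open import Relation.Binary.Definitions using (DecidableEquality)
open import Relation.Binary.PropositionalEquality

IsNode : Tree → Path → Set
IsNode T p = Is-just (at T p)

childAt⇒< : ∀ i ts → Is-just (childAt i ts) → i < length ts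
childAt⇒< zero    (t ∷ ts) _ = s≤s z≤n
childAt⇒< (suc i) (t ∷ ts) c = s≤s (childAt⇒< i ts c)

<⇒childAt : ∀ i ts → i < length ts → Is-just (childAt i ts)
<⇒childAt zero    (t ∷ ts) _       = Maybe.just tt
<⇒childAt (suc i) (t ∷ ts) (s≤s c) = <⇒childAt i ts c

isNode-child⇒<deg : ∀ T i p → IsNode T (i ∷ p) → i < deg T p
isNode-child⇒<deg T i p c with at T p
... | just (node ts) = childAt⇒< i ts c

<deg⇒isNode-child : ∀ T i p → i < deg T p → IsNode T (i ∷ p)
<deg⇒isNode-child T i p i<d with at T p
... | just (node ts) = <⇒childAt i ts i<d

isNode-parent : ∀ T i p → IsNode T (i ∷ p) → IsNode T p
isNode-parent T i p c with at T p
... | just (node ts) = Maybe.just tt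

childAt⇒depth< : ∀ i ts {t} → childAt i ts ≡ just t → suc (depth t) ≤ depthL ts
childAt⇒depth< zero    (t ∷ ts)  refl = m≤m⊔n (suc (depth t)) (depthL ts)
childAt⇒depth< (suc i) (t′ ∷ ts) eq   =
  ≤-trans (childAt⇒depth< i ts eq) (m≤n⊔m (suc (depth t′)) (depthL ts))

at⇒length+depth≤depth : ∀ T p {t} → at T p ≡ just t → length p + depth t ≤ depth T
at⇒length+depth≤depth T []      refl = ≤-refl
at⇒length+depth≤depth T (i ∷ p) {t} eq with at T p in parent
... | just (node ts) = begin
  suc (length p) + depth t   ≡⟨ +-suc (length p) (depth t) ⟨
  length p + suc (depth t)   ≤⟨ +-monoʳ-≤ (length p) (childAt⇒depth< i ts eq) ⟩
  length p + depth (node ts) ≤⟨ at⇒length+depth≤depth T p parent ⟩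
  depth T                    ∎
  where open ≤-Reasoning

isNode⇒length≤depth : ∀ T p → IsNode T p → length p ≤ depth T
isNode⇒length≤depth T p _ with at T p in eq
... | just t = ≤-trans (m≤m+n (length p) (depth t)) (at⇒length+depth≤depth T p eq)

∈?⇒∈ : ∀ {x xs} → (x ∈? xs) ≡ true → x ∈ xs
∈?⇒∈ eq = toWitness (subst True (sym eq) tt)

firstUnexpl-< : ∀ n a p tr {i} → firstUnexpl n a p tr ≡ just i → i < a + n
firstUnexpl-< (suc n) a p tr eq with (a ∷ p) ∈? tr
... | true  = ≤-trans (firstUnexpl-< n (suc a) p tr eq) (≤-reflexive (sym (+-suc a n)))
firstUnexpl-< (suc n) a p tr refl | false = ≤-trans (≤-reflexive (+-comm 1 a)) (+-monoʳ-≤ a (s≤s z≤n))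

moveC-down : ∀ T {i p es} → i < deg T p → es ⊆ (i ∷ p) ∷ [] →
             proj₁ (moveC T p (down i)) ≡ i ∷ p × es ⊆ proj₂ (moveC T p (down i))
moveC-down T {i} {p} i<d es⊆ with i <? deg T p
... | yes _   = refl , es⊆
... | no i≮d = contradiction i<d i≮d

-- moveA splits on the path first, so these clauses do not hold definitionally.
moveA-down : ∀ S p tr u i →
  moveA S p tr u (aDown i) ≡ (if (i ∷ p) ∈? tr then (i ∷ p , []) else (p , []))
moveA-down S []      tr u i = refl
moveA-down S (j ∷ p) tr u i = refl

moveA-explore-none : ∀ S p tr → moveA S p tr nothing aExplore ≡ (p , [])
moveA-explore-none S []      tr = refl
moveA-explore-none S (j ∷ p) tr = refl

moveA-explore : ∀ S p tr i → moveA S p tr (just i) aExplore ≡ (i ∷ p , (i ∷ p) ∷ [])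
moveA-explore S []      tr i = refl
moveA-explore S (j ∷ p) tr i = refl

moveA-tree-irrelevant : ∀ S S′ p tr u a → moveA S p tr u a ≡ moveA S′ p tr u a
moveA-tree-irrelevant S S′ []      tr u aUp      = refl
moveA-tree-irrelevant S S′ (i ∷ p) tr u aUp      = refl
moveA-tree-irrelevant S S′ p tr u (aDown i)      = refl
moveA-tree-irrelevant S S′ p tr nothing  aExplore = refl
moveA-tree-irrelevant S S′ p tr (just i) aExplore = refl

moveA-edges : ∀ S p tr u a {q} → q ∈ proj₂ (moveA S p tr u a) →
              q ≡ p ⊎ q ≡ proj₁ (moveA S p tr u a)
moveA-edges S (i ∷ p) tr u aUp (here refl) = inj₁ refl
moveA-edges S p tr u (aDown i) q∈ rewrite moveA-down S p tr u i with (i ∷ p) ∈? tr | q∈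
... | true  | ()
... | false | ()
moveA-edges S p tr nothing aExplore q∈ rewrite moveA-explore-none S p tr with q∈
... | ()
moveA-edges S p tr (just i) aExplore q∈ rewrite moveA-explore S p tr i with q∈
... | here refl = inj₂ refl

toMove : Path → List Path → Maybe ℕ → AMove → Move
toMove p tr u        aUp       = up
toMove p tr u        (aDown i) = if (i ∷ p) ∈? tr then down i else stay
toMove p tr nothing  aExplore  = stay
toMove p tr (just i) aExplore  = down i

ValidOffer : Tree → Path → Maybe ℕ → Set
ValidOffer T p u = ∀ {i} → u ≡ just i → i < deg T p

module _ (T : Tree) {tr : List Path} (tr-nodes : ∀ {q} → q ∈ tr → IsNode T q) where

  toMove-simulates : ∀ p {u} → ValidOffer T p u → ∀ a →
                     proj₁ (moveC T p (toMove p tr u a)) ≡ proj₁ (moveA T p tr u a)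
                     × proj₂ (moveA T p tr u a) ⊆ proj₂ (moveC T p (toMove p tr u a))
  toMove-simulates []      _ aUp = refl , λ ()
  toMove-simulates (_ ∷ _) _ aUp = refl , λ q∈ → q∈
  toMove-simulates p {u} _ (aDown i) rewrite moveA-down T p tr u i with (i ∷ p) ∈? tr in known
  ... | true  = moveC-down T (isNode-child⇒<deg T i p (tr-nodes (∈?⇒∈ known))) λ ()
  ... | false = refl , λ ()
  toMove-simulates p {nothing} _ aExplore rewrite moveA-explore-none T p tr = refl , λ ()
  toMove-simulates p {just i} i<d aExplore rewrite moveA-explore T p tr i =
    moveC-down T (i<d refl) λ q∈ → q∈

  moveA-target-isNode : ∀ p {u} → ValidOffer T p u → IsNode T p → ∀ a →
                        IsNode T (proj₁ (moveA T p tr u a))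
  moveA-target-isNode []       _ p-node aUp = p-node
  moveA-target-isNode (i ∷ p′) _ p-node aUp = isNode-parent T i p′ p-node
  moveA-target-isNode p {u} _ p-node (aDown i) rewrite moveA-down T p tr u i with (i ∷ p) ∈? tr in known
  ... | true  = tr-nodes (∈?⇒∈ known)
  ... | false = p-node
  moveA-target-isNode p {nothing} _ p-node aExplore rewrite moveA-explore-none T p tr = p-node
  moveA-target-isNode p {just i} i<d _ aExplore rewrite moveA-explore T p tr i =
    <deg⇒isNode-child T i p (i<d refl)

_≟ₚ_ : DecidableEquality Path
_≟ₚ_ = List.≡-dec _≟_

open DecMembership _≟ₚ_ using () renaming (_∈?_ to _∈ₚ?_)

Knowledge : Set
Knowledge = Path → Maybe ℕ

Known : Knowledge → Path → Set
Known κ q = Is-just (κ q)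

Correct : Tree → Knowledge → Set
Correct T κ = ∀ {q d} → κ q ≡ just d → d ≡ deg T q

learn : ∀ {n} → Vec Path n → Vec ℕ n → Knowledge → Knowledge
learn []       []       κ q = κ q
learn (p ∷ ps) (d ∷ ds) κ q with q ≟ₚ p
... | yes _ = just d
... | no  _ = learn ps ds κ q

learn-known : ∀ {n} (ps : Vec Path n) ds κ l → Known (learn ps ds κ) (lookup ps l)
learn-known (p ∷ ps) (d ∷ ds) κ l with lookup (p ∷ ps) l ≟ₚ p
... | yes _ = Maybe.just tt
learn-known (p ∷ ps) (d ∷ ds) κ Fin.zero    | no p≢p = contradiction refl p≢p
learn-known (p ∷ ps) (d ∷ ds) κ (Fin.suc l) | no _   = learn-known ps ds κ l

learn-mono : ∀ {n} (ps : Vec Path n) ds κ {q} → Known κ q → Known (learn ps ds κ) q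
learn-mono []       []       κ known = known
learn-mono (p ∷ ps) (d ∷ ds) κ {q} known with q ≟ₚ p
... | yes _ = Maybe.just tt
... | no  _ = learn-mono ps ds κ known

learn-correct : ∀ T {n} (ps : Vec Path n) {κ} → Correct T κ →
                Correct T (learn ps (Vec.map (deg T) ps) κ)
learn-correct T []       correct eq = correct eq
learn-correct T (p ∷ ps) {κ} correct {q} eq with q ≟ₚ p
learn-correct T (p ∷ ps) {κ} correct {q} refl | yes refl = refl
... | no  _    = learn-correct T ps correct eq

Mined : Knowledge → List Path → Path → Set
Mined κ tr q = Maybe.Any (λ d → (i : Fin d) → (toℕ i ∷ q) ∈ tr) (κ q)

AllMined : Knowledge → List Path → Set
AllMined κ tr = All (Mined κ tr) ([] ∷ tr)

allMined? : ∀ κ tr → Dec (AllMined κ tr)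
allMined? κ tr = All.all? mined? ([] ∷ tr)
  where
    mined? : ∀ q → Dec (Mined κ tr q)
    mined? q = Maybe.dec (λ d → Fin.all? λ i → (toℕ i ∷ q) ∈ₚ? tr) (κ q)

module _ {T : Tree} {κ : Knowledge} (correct : Correct T κ) {tr : List Path} where

  allMined⇒allTraversed : AllMined κ tr → AllTraversed T tr
  allMined⇒allTraversed mined = traversed
    where
      below-mined : ∀ {i p} → IsNode T (i ∷ p) → Mined κ tr p → (i ∷ p) ∈ tr
      below-mined {i} {p} child m with κ p in eq | m
      ... | just d | Maybe.just all-below with correct eq
      ... | refl = subst (λ j → (j ∷ p) ∈ tr) (Fin.toℕ-fromℕ< i<d) (all-below (fromℕ< i<d))
        where i<d = isNode-child⇒<deg T i p child
      traversed : AllTraversed T tr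
      traversed i []      child = below-mined child (All.lookup mined (here refl))
      traversed i (j ∷ p) child =
        below-mined child (All.lookup mined (there (traversed j p (isNode-parent T i (j ∷ p) child))))

  allTraversed⇒allMined : All (Known κ) ([] ∷ tr) → AllTraversed T tr → AllMined κ tr
  allTraversed⇒allMined known traversed = All.map mined known
    where
      mined : ∀ {q} → Known κ q → Mined κ tr q
      mined {q} k with κ q in eq | k
      ... | just d | _ with correct eq
      ... | refl = Maybe.just λ i → traversed (toℕ i) q (<deg⇒isNode-child T (toℕ i) q (Fin.toℕ<n i))

offer : ∀ {k} → AState k → Fin k → ℕ → Maybe ℕ
offer st r d = firstUnexpl d 0 (lookup (apos st) r) (atrav st)

translate : ∀ {k} → ACTEAlg k → AState k → Fin k → ℕ → Move
translate B st r d =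
  toMove (lookup (apos st) r) (atrav st) (offer st r d) (B ((r , is-just (offer st r d)) ∷ ahist st))

module Steps {k} (T : Tree) (B : ACTEAlg k) where

  record Consistent (κ : Knowledge) (st : AState k) : Set where
    field
      edges-nodes     : ∀ {q} → q ∈ atrav st → IsNode T q
      positions-nodes : ∀ l → IsNode T (lookup (apos st) l)
      covered         : ∀ {q} → q ∈ [] ∷ atrav st → Known κ q ⊎ ∃ λ l → lookup (apos st) l ≡ q
  open Consistent public

  consistent-mono : ∀ {κ κ′ st} → (∀ {q} → Known κ q → Known κ′ q) →
                    Consistent κ st → Consistent κ′ st
  edges-nodes     (consistent-mono _ cons) = edges-nodes cons
  positions-nodes (consistent-mono _ cons) = positions-nodes cons
  covered         (consistent-mono learnt cons) q∈ with covered cons q∈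
  ... | inj₁ known    = inj₁ (learnt known)
  ... | inj₂ position = inj₂ position

  cteStep : AState k → Fin k → Path × List Path
  cteStep st r = moveC T (lookup (apos st) r) (translate B st r (deg T (lookup (apos st) r)))

  module _ {κ st} (cons : Consistent κ st) (r : Fin k) where

    private
      p : Path
      p = lookup (apos st) r

      u : Maybe ℕ
      u = offer st r (deg T p)

      a : AMove
      a = B ((r , is-just u) ∷ ahist st)

      res : Path × List Path
      res = moveA T p (atrav st) u a

      u<deg : ValidOffer T p u
      u<deg = firstUnexpl-< (deg T p) 0 p (atrav st)

      simulated : proj₁ (cteStep st r) ≡ proj₁ res × proj₂ res ⊆ proj₂ (cteStep st r)
      simulated = toMove-simulates T (edges-nodes cons) p u<deg a

      updated≢ : ∀ {l} → l ≢ r → lookup (apos (aStep T B st r)) l ≡ lookup (apos st) l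
      updated≢ l≢r = Vec.lookup∘update′ l≢r (apos st) (proj₁ res)

      updated : lookup (apos (aStep T B st r)) r ≡ proj₁ res
      updated = Vec.lookup∘update r (apos st) (proj₁ res)

      still-covered : Known κ p → ∀ {q} → Known κ q ⊎ (∃ λ l → lookup (apos st) l ≡ q) →
                      Known κ q ⊎ ∃ λ l → lookup (apos (aStep T B st r)) l ≡ q
      still-covered _       (inj₁ known)    = inj₁ known
      still-covered p-known (inj₂ (l , refl)) with l Fin.≟ r
      ... | yes refl = inj₁ p-known
      ... | no  l≢r  = inj₂ (l , updated≢ l≢r)

      target-node : IsNode T (proj₁ res)
      target-node = moveA-target-isNode T (edges-nodes cons) p u<deg (positions-nodes cons r) a

    aStep-positions : apos (aStep T B st r) ≡ apos st [ r ]≔ proj₁ (cteStep st r)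
    aStep-positions = cong (apos st [ r ]≔_) (sym (proj₁ simulated))

    aStep-traversed : atrav (aStep T B st r) ⊆ atrav st ++ proj₂ (cteStep st r)
    aStep-traversed q∈ with ∈-++⁻ (atrav st) q∈
    ... | inj₁ old = ∈-++⁺ˡ old
    ... | inj₂ new = ∈-++⁺ʳ (atrav st) (proj₂ simulated new)

    aStep-consistent : Known κ p → Consistent κ (aStep T B st r)
    edges-nodes (aStep-consistent _) q∈ with ∈-++⁻ (atrav st) q∈
    ... | inj₁ old = edges-nodes cons old
    ... | inj₂ new with moveA-edges T p (atrav st) u a new
    ...   | inj₁ refl = positions-nodes cons r
    ...   | inj₂ refl = target-node
    positions-nodes (aStep-consistent _) l with l Fin.≟ r
    ... | yes refl = subst (IsNode T) (sym updated) target-node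
    ... | no  l≢r  = subst (IsNode T) (sym (updated≢ l≢r)) (positions-nodes cons l)
    covered (aStep-consistent p-known) (here refl) = still-covered p-known (covered cons (here refl))
    covered (aStep-consistent p-known) (there q∈) with ∈-++⁻ (atrav st) q∈
    ... | inj₁ old = still-covered p-known (covered cons (there old))
    ... | inj₂ new with moveA-edges T p (atrav st) u a new
    ...   | inj₁ refl = inj₁ p-known
    ...   | inj₂ refl = inj₂ (r , updated)

lookup-ext : ∀ {A : Set} {n} {xs ys : Vec A n} → (∀ l → lookup xs l ≡ lookup ys l) → xs ≡ ys
lookup-ext same = Pointwise-≡⇒≡ (extensional⇒inductive (ext same))

⌈/⌉-monoˡ-≤ : ∀ n .{{_ : NonZero n}} {m m′} → m ≤ m′ → ⌈ m / n ⌉ ≤ ⌈ m′ / n ⌉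
⌈/⌉-monoˡ-≤ n m≤m′ = /-monoˡ-≤ n (+-monoˡ-≤ (n ∸ 1) m≤m′)

m≤⌈m/n⌉*n : ∀ m n .{{_ : NonZero n}} → m ≤ ⌈ m / n ⌉ * n
m≤⌈m/n⌉*n m n = +-cancelʳ-≤ (n ∸ 1) m (⌈ m / n ⌉ * n) (begin
  m + (n ∸ 1)                             ≡⟨ m≡m%n+[m/n]*n (m + (n ∸ 1)) n ⟩
  (m + (n ∸ 1)) % n + ⌈ m / n ⌉ * n       ≤⟨ +-monoˡ-≤ (⌈ m / n ⌉ * n) (<⇒≤pred (m%n<n (m + (n ∸ 1)) n)) ⟩
  pred n + ⌈ m / n ⌉ * n                  ≡⟨ cong (_+ ⌈ m / n ⌉ * n) (pred≡∸1 n) ⟩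
  (n ∸ 1) + ⌈ m / n ⌉ * n                 ≡⟨ +-comm (n ∸ 1) _ ⟩
  ⌈ m / n ⌉ * n + (n ∸ 1)                 ∎)
  where
    open ≤-Reasoning
    pred≡∸1 : ∀ n → pred n ≡ n ∸ 1
    pred≡∸1 zero    = refl
    pred≡∸1 (suc n) = refl

aRun-traversed-mono : ∀ {k} T (B : ACTEAlg k) r {t t′} → t ≤ t′ →
                      atrav (aRun T B r t) ⊆ atrav (aRun T B r t′)
aRun-traversed-mono T B r {t} {t′} t≤t′ =
  subst (λ t″ → atrav (aRun T B r t) ⊆ atrav (aRun T B r t″)) (m+[n∸m]≡n t≤t′) (grow (t′ ∸ t))
  where
    grow : ∀ n → atrav (aRun T B r t) ⊆ atrav (aRun T B r (t + n))
    grow zero    rewrite +-identityʳ t = λ q∈ → q∈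
    grow (suc n) rewrite +-suc t n     = λ q∈ → ∈-++⁺ˡ (grow n q∈)

cStep-up : ∀ {k} T (A : CTEAlg k) cs → A (chist cs) ≡ replicate k up → ∀ l →
           length (lookup (cpos (cStep T A cs)) l) ≡ pred (length (lookup (cpos cs) l))
cStep-up {k} T A cs ups l = begin
  length (lookup (Vec.map proj₁ steps) l)
    ≡⟨ cong length (Vec.lookup-map l proj₁ steps) ⟩
  length (proj₁ (lookup steps l))
    ≡⟨ cong (length ∘ proj₁) (Vec.lookup-zipWith (moveC T) l (cpos cs) (A (chist cs))) ⟩
  length (proj₁ (moveC T p (lookup (A (chist cs)) l)))
    ≡⟨ cong (λ as → length (proj₁ (moveC T p (lookup as l)))) ups ⟩
  length (proj₁ (moveC T p (lookup (replicate k up) l)))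
    ≡⟨ cong (λ a → length (proj₁ (moveC T p a))) (Vec.lookup-replicate l up) ⟩
  length (proj₁ (moveC T p up))
    ≡⟨ up-length p ⟩
  pred (length p) ∎
  where
    open ≡-Reasoning

    steps : Vec (Path × List Path) k
    steps = zipWith (moveC T) (cpos cs) (A (chist cs))

    p : Path
    p = lookup (cpos cs) l

    up-length : ∀ p → length (proj₁ (moveC T p up)) ≡ pred (length p)
    up-length []      = refl
    up-length (_ ∷ _) = refl

module Simulation (k : ℕ) .{{_ : NonZero k}} (B : ACTEAlg k) where

  roundRobin : ℕ → Fin k
  roundRobin t = t mod k

  toℕ-roundRobin : ∀ {j} → j < k → toℕ (roundRobin j) ≡ j
  toℕ-roundRobin {j} j<k = trans (Fin.toℕ-fromℕ< (m%n<n j k)) (m<n⇒m%n≡m j<k)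

  roundRobin-periodic : ∀ s j → roundRobin (s * k + j) ≡ roundRobin j
  roundRobin-periodic s j = Fin.toℕ-injective (begin
    toℕ (roundRobin (s * k + j)) ≡⟨ Fin.toℕ-fromℕ< (m%n<n (s * k + j) k) ⟩
    (s * k + j) % k              ≡⟨ cong (_% k) (+-comm (s * k) j) ⟩
    (j + s * k) % k              ≡⟨ [m+kn]%n≡m%n j s k ⟩
    j % k                        ≡⟨ Fin.toℕ-fromℕ< (m%n<n j k) ⟨
    toℕ (roundRobin j)           ∎)
    where open ≡-Reasoning

  -- aStep with the degree of the moving robot's node supplied as d, so that the team can run it
  -- without knowing the tree (moveA ignores its tree argument).
  simStep : ℕ → AState k → Fin k → AState k
  simStep d st r = astate (apos st [ r ]≔ proj₁ res) (atrav st ++ proj₂ res) history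
    where
      history : List (Fin k × Bool)
      history = (r , is-just (offer st r d)) ∷ ahist st

      res : Path × List Path
      res = moveA (node []) (lookup (apos st) r) (atrav st) (offer st r d) (B history)

  simStep-deg : ∀ T st r → simStep (deg T (lookup (apos st) r)) st r ≡ aStep T B st r
  simStep-deg T st r = cong (λ res → astate (apos st [ r ]≔ proj₁ res) (atrav st ++ proj₂ res) history)
                            (moveA-tree-irrelevant (node []) T p (atrav st) u (B history))
    where
      p : Path
      p = lookup (apos st) r

      u : Maybe ℕ
      u = offer st r (deg T p)

      history : List (Fin k × Bool)
      history = (r , is-just u) ∷ ahist st

  -- the first j steps of a round-robin round, robot l reading its degree from o
  simRound : Obs k → ℕ → AState k → AState k
  simRound o zero    st = st
  simRound o (suc j) st = simStep (lookup o (roundRobin j)) (simRound o j st) (roundRobin j)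

  roundMoves : Obs k → AState k → Vec Move k
  roundMoves o st = tabulate λ l → translate B (simRound o (toℕ l) st) l (lookup o l)

  homeward : Vec Move k
  homeward = replicate k up

  record Controller : Set where
    constructor controller
    field
      simState  : AState k
      knowledge : Knowledge
      returning : Bool
  open Controller public

  planRound : (st : AState k) (κ : Knowledge) → Obs k → Dec (AllMined κ (atrav st)) →
              Controller × Vec Move k
  planRound st κ o (yes _) = controller st κ true , homeward
  planRound st κ o (no _)  = controller (simRound o k st) κ false , roundMoves o st

  plan : Controller → Obs k → Controller × Vec Move k
  plan (controller st κ true)  o = controller st κ true , homeward
  plan (controller st κ false) o = planRound st κ′ o (allMined? κ′ (atrav st))
    where κ′ = learn (apos st) o κ

  learned : Controller → Obs k → Knowledge
  learned C o = learn (apos (simState C)) o (knowledge C)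

  plan-returning : ∀ C o → returning C ≡ true → plan C o ≡ (C , homeward)
  plan-returning (controller st κ _) o refl = refl

  plan-mined : ∀ C o → returning C ≡ false → AllMined (learned C o) (atrav (simState C)) →
               plan C o ≡ (controller (simState C) (learned C o) true , homeward)
  plan-mined (controller st κ _) o refl mined with allMined? (learn (apos st) o κ) (atrav st)
  ... | yes _     = refl
  ... | no  ¬mined = contradiction mined ¬mined

  plan-unmined : ∀ C o → returning C ≡ false → ¬ AllMined (learned C o) (atrav (simState C)) →
                 plan C o ≡ (controller (simRound o k (simState C)) (learned C o) false ,
                             roundMoves o (simState C))
  plan-unmined (controller st κ _) o refl ¬mined with allMined? (learn (apos st) o κ) (atrav st)
  ... | yes mined = contradiction mined ¬mined
  ... | no  _     = refl

  initial : Controller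
  initial = controller (aInit k) (λ _ → nothing) false

  controllerAfter : List (Obs k) → Controller
  controllerAfter []      = initial
  controllerAfter (o ∷ h) = proj₁ (plan (controllerAfter h) o)

  -- cRun never consults the empty history: it always contains the current observation.
  simulate : CTEAlg k
  simulate []      = homeward
  simulate (o ∷ h) = proj₂ (plan (controllerAfter h) o)

  module Correctness (T : Tree) where

    open Steps T B

    module Round (st : AState k) (κ : Knowledge) (o : Obs k) (o-deg : o ≡ Vec.map (deg T) (apos st))
                 (known : ∀ l → Known κ (lookup (apos st) l)) (cons : Consistent κ st) where

      moves : Vec (Path × List Path) k
      moves = zipWith (moveC T) (apos st) (roundMoves o st)

      edges : List Path
      edges = concat (toList (Vec.map proj₂ moves))

      moves-edges : ∀ l → proj₂ (lookup moves l) ⊆ edges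
      moves-edges l q∈ = ∈-concat⁺′ q∈ (subst (_∈ toList (Vec.map proj₂ moves)) (Vec.lookup-map l proj₂ moves)
                                             (∈-toList⁺ (∈-lookup l (Vec.map proj₂ moves))))

      record Progress (s′ : AState k) (j : ℕ) : Set where
        field
          waiting    : ∀ l → j ≤ toℕ l → lookup (apos s′) l ≡ lookup (apos st) l
          moved      : ∀ l → toℕ l < j → lookup (apos s′) l ≡ proj₁ (lookup moves l)
          traversed  : atrav s′ ⊆ atrav st ++ edges
          consistent : Consistent κ s′
      open Progress

      start : Progress st 0
      waiting    start l _ = refl
      moved      start l ()
      traversed  start     = ∈-++⁺ˡ
      consistent start     = cons

      module Turn {j} (j<k : j < k) (progress : Progress (simRound o j st) j) where

        s′ : AState k
        s′ = simRound o j st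

        l : Fin k
        l = roundRobin j

        p : Path
        p = lookup (apos s′) l

        p-start : p ≡ lookup (apos st) l
        p-start = waiting progress l (≤-reflexive (sym (toℕ-roundRobin j<k)))

        o-p : lookup o l ≡ deg T p
        o-p = trans (cong (λ o → lookup o l) o-deg)
                    (trans (Vec.lookup-map l (deg T) (apos st)) (cong (deg T) (sym p-start)))

        turn-aStep : simRound o (suc j) st ≡ aStep T B s′ l
        turn-aStep = trans (cong (λ d → simStep d s′ l) o-p) (simStep-deg T s′ l)

        moves-l : lookup moves l ≡ cteStep s′ l
        moves-l = begin
          lookup moves l
            ≡⟨ Vec.lookup-zipWith (moveC T) l (apos st) (roundMoves o st) ⟩
          moveC T (lookup (apos st) l) (lookup (roundMoves o st) l)
            ≡⟨ cong₂ (moveC T) (sym p-start) (Vec.lookup∘tabulate _ l) ⟩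
          moveC T p (translate B (simRound o (toℕ l) st) l (lookup o l))
            ≡⟨ cong₂ (λ i d → moveC T p (translate B (simRound o i st) l d)) (toℕ-roundRobin j<k) o-p ⟩
          cteStep s′ l ∎
          where open ≡-Reasoning

        advanced : Progress (aStep T B s′ l) (suc j)
        waiting advanced l′ j<l′ = begin
          lookup (apos (aStep T B s′ l)) l′
            ≡⟨ cong (λ ps → lookup ps l′) (aStep-positions (consistent progress) l) ⟩
          lookup (apos s′ [ l ]≔ _) l′
            ≡⟨ Vec.lookup∘update′ l′≢l (apos s′) _ ⟩
          lookup (apos s′) l′
            ≡⟨ waiting progress l′ (≤-trans (n≤1+n j) j<l′) ⟩
          lookup (apos st) l′ ∎
          where
            open ≡-Reasoning
            l′≢l : l′ ≢ l
            l′≢l refl = <-irrefl (sym (toℕ-roundRobin j<k)) j<l′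
        moved advanced l′ l′≤j rewrite aStep-positions (consistent progress) l with l′ Fin.≟ l
        ... | yes refl = trans (Vec.lookup∘update l (apos s′) _) (sym (cong proj₁ moves-l))
        ... | no  l′≢l = trans (Vec.lookup∘update′ l′≢l (apos s′) _)
                                (moved progress l′ (≤∧≢⇒< (s≤s⁻¹ l′≤j) λ l′≡j →
                                  l′≢l (Fin.toℕ-injective (trans l′≡j (sym (toℕ-roundRobin j<k))))))
        traversed advanced q∈ with ∈-++⁻ (atrav s′) (aStep-traversed (consistent progress) l q∈)
        ... | inj₁ old = traversed progress old
        ... | inj₂ new = ∈-++⁺ʳ (atrav st) (moves-edges l (subst (λ m → _ ∈ proj₂ m) (sym moves-l) new))
        consistent advanced =
          aStep-consistent (consistent progress) l (subst (Known κ) (sym p-start) (known l))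

      progress : ∀ j → j ≤ k → Progress (simRound o j st) j
      progress zero    _   = start
      progress (suc j) j<k = subst (λ s′ → Progress s′ (suc j)) (sym turn-aStep) advanced
        where open Turn j<k (progress j (<⇒≤ j<k))

      round-synced : ∀ s → st ≡ aRun T B roundRobin (s * k) → ∀ j → j ≤ k →
                     simRound o j st ≡ aRun T B roundRobin (s * k + j)
      round-synced s synced zero    _   = trans synced (cong (aRun T B roundRobin) (sym (+-identityʳ (s * k))))
      round-synced s synced (suc j) j<k = begin
        simRound o (suc j) st
          ≡⟨ turn-aStep ⟩
        aStep T B (simRound o j st) (roundRobin j)
          ≡⟨ cong₂ (aStep T B) (round-synced s synced j (<⇒≤ j<k)) (sym (roundRobin-periodic s j)) ⟩
        aRun T B roundRobin (suc (s * k + j))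
          ≡⟨ cong (aRun T B roundRobin) (+-suc (s * k) j) ⟨
        aRun T B roundRobin (s * k + suc j) ∎
        where
          open ≡-Reasoning
          open Turn j<k (progress j (<⇒≤ j<k))

      completed : Progress (simRound o k st) k
      completed = progress k ≤-refl

      round-positions : apos (simRound o k st) ≡ Vec.map proj₁ moves
      round-positions = lookup-ext λ l →
        trans (moved completed l (Fin.toℕ<n l)) (sym (Vec.lookup-map l proj₁ moves))

    rounds : ℕ → CState k
    rounds = cRun T simulate

    observation : ℕ → Obs k
    observation s = observe T (cpos (rounds s))

    earlier : ℕ → List (Obs k)
    earlier zero    = []
    earlier (suc s) = chist (rounds s)

    controllerAt : ℕ → Controller
    controllerAt s = controllerAfter (earlier s)

    history-rounds : ∀ s → chist (rounds s) ≡ observation s ∷ earlier s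
    history-rounds zero    = refl
    history-rounds (suc s) = refl

    moves-at : ∀ s → simulate (chist (rounds s)) ≡ proj₂ (plan (controllerAt s) (observation s))
    moves-at s = cong simulate (history-rounds s)

    controllerAt-suc : ∀ s → controllerAt (suc s) ≡ proj₁ (plan (controllerAt s) (observation s))
    controllerAt-suc s = cong controllerAfter (history-rounds s)

    record Tracks (C : Controller) (cs : CState k) (s : ℕ) : Set where
      field
        exploring          : returning C ≡ false
        synced             : simState C ≡ aRun T B roundRobin (s * k)
        same-positions     : cpos cs ≡ apos (simState C)
        traversed-included : atrav (simState C) ⊆ ctrav cs
        correct            : Correct T (knowledge C)
        consistent         : Consistent (knowledge C) (simState C)
    open Tracks

    InSync : ℕ → Set
    InSync s = Tracks (controllerAt s) (rounds s) s

    in-sync-initially : InSync 0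
    exploring          in-sync-initially = refl
    synced             in-sync-initially = refl
    same-positions     in-sync-initially = refl
    traversed-included in-sync-initially ()
    correct            in-sync-initially ()
    edges-nodes     (consistent in-sync-initially) ()
    positions-nodes (consistent in-sync-initially) l =
      subst (IsNode T) (sym (Vec.lookup-replicate l [])) (Maybe.just tt)
    covered         (consistent in-sync-initially) (here refl) =
      inj₂ (roundRobin 0 , Vec.lookup-replicate (roundRobin 0) [])

    record Returning (s h : ℕ) : Set where
      field
        all-traversed : AllTraversed T (ctrav (rounds s))
        heights       : ∀ l → length (lookup (cpos (rounds s)) l) ≤ h
        moving-up     : simulate (chist (rounds s)) ≡ homeward
        will-return   : returning (controllerAt (suc s)) ≡ true
    open Returning

    returning-persists : ∀ s → returning (controllerAt s) ≡ true →
                         simulate (chist (rounds s)) ≡ homeward × returning (controllerAt (suc s)) ≡ true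
    returning-persists s is-returning =
      trans (moves-at s) (cong proj₂ plan≡) ,
      trans (cong returning (controllerAt-suc s)) (trans (cong (returning ∘ proj₁) plan≡) is-returning)
      where
        plan≡ : plan (controllerAt s) (observation s) ≡ (controllerAt s , homeward)
        plan≡ = plan-returning (controllerAt s) (observation s) is-returning

    returning-step : ∀ {s h} → Returning s h → Returning (suc s) (pred h)
    all-traversed (returning-step r) i p child = ∈-++⁺ˡ (all-traversed r i p child)
    heights       (returning-step {s} r) l     =
      subst (_≤ _) (sym (cStep-up T simulate (rounds s) (moving-up r) l)) (pred-mono-≤ (heights r l))
    moving-up     (returning-step {s} r)       = proj₁ (returning-persists (suc s) (will-return r))
    will-return   (returning-step {s} r)       = proj₂ (returning-persists (suc s) (will-return r))

    returning-home : ∀ n {s h} → Returning s h → Returning (n + s) (h ∸ n)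
    returning-home zero    r = r
    returning-home (suc n) {h = h} r =
      subst (Returning (suc n + _)) (pred[m∸n]≡m∸[1+n] h n) (returning-step (returning-home n r))

    ExploredBy : ℕ → Set
    ExploredBy s = AllTraversed T (atrav (aRun T B roundRobin (s * k)))

    module _ {s} (sync : InSync s) where

      private
        C : Controller
        C = controllerAt s

        st : AState k
        st = simState C

        o : Obs k
        o = observation s

        κ : Knowledge
        κ = learned C o

        o-deg : o ≡ Vec.map (deg T) (apos st)
        o-deg = cong (Vec.map (deg T)) (same-positions sync)

        κ-correct : Correct T κ
        κ-correct = subst (λ o → Correct T (learn (apos st) o (knowledge C))) (sym o-deg)
                          (learn-correct T (apos st) (correct sync))

        κ-knows-positions : ∀ l → Known κ (lookup (apos st) l)
        κ-knows-positions = learn-known (apos st) o (knowledge C)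

        κ-knows-explored : All (Known κ) ([] ∷ atrav st)
        κ-knows-explored = All.tabulate λ q∈ → learned-if-covered (covered (consistent sync) q∈)
          where
            learned-if-covered : ∀ {q} → Known (knowledge C) q ⊎ (∃ λ l → lookup (apos st) l ≡ q) →
                                 Known κ q
            learned-if-covered (inj₁ known)    = learn-mono (apos st) o (knowledge C) known
            learned-if-covered (inj₂ (l , refl)) = κ-knows-positions l

      mined⇒returning : AllMined κ (atrav st) → Returning s (depth T)
      mined⇒returning mined = record
        { all-traversed = λ i p child → traversed-included sync (allMined⇒allTraversed κ-correct mined i p child)
        ; heights       = λ l → isNode⇒length≤depth T (lookup (cpos (rounds s)) l)
                                  (subst (λ ps → IsNode T (lookup ps l)) (sym (same-positions sync))
                                         (positions-nodes (consistent sync) l))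
        ; moving-up     = trans (moves-at s) (cong proj₂ plan≡)
        ; will-return   = trans (cong returning (controllerAt-suc s)) (cong (returning ∘ proj₁) plan≡)
        }
        where
          plan≡ : plan C o ≡ (controller st κ true , homeward)
          plan≡ = plan-mined C o (exploring sync) mined

      unmined⇒in-sync : ¬ AllMined κ (atrav st) → InSync (suc s)
      unmined⇒in-sync unmined = subst (λ C′ → Tracks C′ (rounds (suc s)) (suc s)) (sym next-controller) tracks
        where
          open Round st κ o o-deg κ-knows-positions
                     (consistent-mono (learn-mono (apos st) o (knowledge C)) (consistent sync))

          plan≡ : plan C o ≡ (controller (simRound o k st) κ false , roundMoves o st)
          plan≡ = plan-unmined C o (exploring sync) unmined

          next-controller : controllerAt (suc s) ≡ controller (simRound o k st) κ false
          next-controller = trans (controllerAt-suc s) (cong proj₁ plan≡)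

          executed : zipWith (moveC T) (cpos (rounds s)) (simulate (chist (rounds s))) ≡ moves
          executed = cong₂ (zipWith (moveC T)) (same-positions sync) (trans (moves-at s) (cong proj₂ plan≡))

          tracks : Tracks (controller (simRound o k st) κ false) (rounds (suc s)) (suc s)
          exploring          tracks = refl
          synced             tracks = trans (round-synced s (synced sync) k ≤-refl)
                                            (cong (aRun T B roundRobin) (+-comm (s * k) k))
          same-positions     tracks = trans (cong (Vec.map proj₁) executed) (sym round-positions)
          traversed-included tracks q∈ with ∈-++⁻ (atrav st) (Progress.traversed completed q∈)
          ... | inj₁ old = ∈-++⁺ˡ (traversed-included sync old)
          ... | inj₂ new = ∈-++⁺ʳ (ctrav (rounds s))
                                  (subst (λ ms → _ ∈ concat (toList (Vec.map proj₂ ms))) (sym executed) new)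
          correct            tracks = κ-correct
          consistent         tracks = Progress.consistent completed

      unmined⇒unexplored : ¬ AllMined κ (atrav st) → ¬ ExploredBy s
      unmined⇒unexplored unmined explored = unmined (allTraversed⇒allMined κ-correct κ-knows-explored
                                                       (subst (AllTraversed T ∘ atrav) (sym (synced sync)) explored))

      round-outcome : Returning s (depth T) ⊎ (InSync (suc s) × ¬ ExploredBy s)
      round-outcome with allMined? κ (atrav st)
      ... | yes mined   = inj₁ (mined⇒returning mined)
      ... | no  unmined = inj₂ (unmined⇒in-sync unmined , unmined⇒unexplored unmined)

    finishes : ∀ n s → InSync s → ExploredBy (s + n) → ∃ λ f → f ≤ s + n × Returning f (depth T)
    finishes n s sync explored with round-outcome sync
    ... | inj₁ done = s , m≤m+n s n , done
    finishes zero    s sync explored | inj₂ (_ , unexplored) =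
      contradiction (subst ExploredBy (+-identityʳ s) explored) unexplored
    finishes (suc n) s sync explored | inj₂ (sync′ , _)
      with finishes n (suc s) sync′ (subst ExploredBy (+-suc s n) explored)
    ... | f , f≤ , done = f , subst (f ≤_) (sym (+-suc s n)) f≤ , done

    runtime-bound : ∀ m → MovesAtMost B T m → RuntimeAtMost simulate T (⌈ m / k ⌉ + depth T)
    runtime-bound m bounded with bounded roundRobin
    ... | t , t≤m , explored
      with finishes ⌈ t / k ⌉ 0 in-sync-initially
                    (λ i p child → aRun-traversed-mono T B roundRobin (m≤⌈m/n⌉*n t k) (explored i p child))
    ... | f , f≤ , done = depth T + f , bound , all-traversed home , lookup-ext at-root
      where
        home : Returning (depth T + f) (depth T ∸ depth T)
        home = returning-home (depth T) done

        bound : depth T + f ≤ ⌈ m / k ⌉ + depth T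
        bound = subst (_≤ ⌈ m / k ⌉ + depth T) (+-comm f (depth T))
                      (+-monoˡ-≤ (depth T) (≤-trans f≤ (⌈/⌉-monoˡ-≤ k t≤m)))
        at-root : ∀ l → lookup (cpos (rounds (depth T + f))) l ≡ lookup (replicate k []) l
        at-root l = trans (root (≤-trans (heights home l) (≤-reflexive (n∸n≡0 (depth T)))))
                          (sym (Vec.lookup-replicate l []))
          where
            root : ∀ {p : Path} → length p ≤ 0 → p ≡ []
            root {[]} _ = refl

theorem3p2 : (k : ℕ) → .{{_ : NonZero k}} → (B : ACTEAlg k) →
    Σ (CTEAlg k) λ A → (T : Tree) → (m : ℕ) →
      MovesAtMost B T m → RuntimeAtMost A T (⌈ m / k ⌉ + depth T)
theorem3p2 k B = simulate , λ T → Correctness.runtime-bound T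
  where open Simulation k B
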